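{- Suppose that $\sigma$ is constant-free, $\varphi$ is a $\mathsf{GML}^{\mathsf{i,u}}(\sigma)$-formula or $\varphi(x)$ is an equality-free $\mathsf{C}^2(\sigma)$-formula, and that $k^\bullet<\kappa<\kappa'\in \mathbb{N}^{\infty}$. Then $\mathfrak{A}^\kappa \models \varphi(a,i)$ iff $\mathfrak{A}^\kappa \models \mathit{fl}(\varphi)(a,i)$ iff $\mathfrak{A}^{\kappa'} \models \mathit{fl}(\varphi)(a,i)$ iff $\mathfrak{A}^{\kappa'}\models \varphi(a,i)$, for all pointed $\sigma$-structures $\mathfrak{A},a$ and all $i <\kappa$.
   Context: $\mathsf{GML}^{\mathsf{i,u}}$ is graded modal logic with graded diamonds $\Diamond_R^{\ge k}$, inverse graded diamonds $\Diamond_{R^- }^{\ge k}$ and the universal diamond $\mathsf{E}\varphi$ (true iff $\varphi$ holds at some element); $\mathsf{C}^2$ is two-variable FO with counting quantifiers $\exists^{\ge k}x$. $\mathbb{N}^{\infty}=\{1,2,\dots\}\cup\{\omega\}$. For a $\sigma$-structure $\mathfrak{A}$ and $\kappa\in\mathbb{N}^\infty$, the $\kappa$-expansion $\mathfrak{A}^\kappa$ has domain $\bigcup_{a\in\mathrm{dom}(\mathfrak{A})}\bar a$ with $\bar a=\{(a,0)\}$ if $a$ interprets a constant and $\bar a=\{(a,i)\mid 0\le i<\kappa\}$ otherwise, $A^{\mathfrak{A}^\kappa}=\bigcup_{a\in A^{\mathfrak{A}}}\bar a$, $R^{\mathfrak{A}^\kappa}=\bigcup_{(a,b)\in R^{\mathfrak{A}}}\bar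 a\times\bar b$. The flattening $\mathit{fl}(\varphi)$ replaces every $\Diamond_R^{\ge k}$ (resp. $\Diamond_{R^- }^{\ge k}$) by $\Diamond_R$ (resp. $\Diamond_{R^- }$), and in $\mathsf{C}^2$ every $\exists^{\ge k}x$ by $\exists x$. $k^\bullet$ is the largest $k$ of a graded modality or counting quantifier occurring in $\varphi$. -}

module Defs where

open import Data.Nat using (ℕ; zero; suc; _<_; _⊔_; s≤s; z≤n)
open import Data.Nat.Properties using (<-trans)
open import Data.Fin using (Fin)
open import Data.Bool using (Bool; true; false; _∨_)
open import Data.Product using (Σ; _×_; _,_)
open import Data.Unit using (⊤; tt)
open import Data.Empty using (⊥)
open import Relation.Nullary using (¬_)
open import Relation.Binary.PropositionalEquality using (_≡_)
open import Function.Definitions using (Injective)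

-- ℕ^∞ = {1,2,...} ∪ {ω}.  fin n stands for the natural number n;
-- fin 0 is representable but harmless: the lemma assumes i < κ, so κ ≥ 1.

data ℕ∞ : Set where
  fin : ℕ → ℕ∞
  ω   : ℕ∞

_<ι_ : ℕ → ℕ∞ → Set
i <ι fin n = i < n
i <ι ω     = ⊤

_<∞_ : ℕ∞ → ℕ∞ → Set
fin m <∞ fin n = m < n
fin m <∞ ω     = ⊤
ω     <∞ _     = ⊥

<ι-<∞ : ∀ {i κ κ'} → i <ι κ → κ <∞ κ' → i <ι κ'
<ι-<∞ {κ = fin m} {fin n} p q = <-trans p q
<ι-<∞ {κ = fin m} {ω}     p q = tt
<ι-<∞ {κ = ω}     {fin n} p ()
<ι-<∞ {κ = ω}     {ω}     p ()

record Sig : Set₁ where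
  field
    UName : Set
    BName : Set

open Sig public

record Struct (σ : Sig) : Set₁ where
  field
    Dom : Set
    un  : UName σ → Dom → Set
    bin : BName σ → Dom → Dom → Set

open Struct public

expand : ∀ {σ} → Struct σ → ℕ∞ → Struct σ
expand 𝔄 κ = record
  { Dom = Σ (Dom 𝔄) (λ a → Σ ℕ (λ i → i <ι κ))
  ; un  = λ A d → un 𝔄 A (Data.Product.proj₁ d)
  ; bin = λ R d e → bin 𝔄 R (Data.Product.proj₁ d) (Data.Product.proj₁ e)
  }

copy : ∀ {σ} (𝔄 : Struct σ) (κ : ℕ∞) (a : Dom 𝔄) (i : ℕ) → i <ι κ → Dom (expand 𝔄 κ)
copy 𝔄 κ a i p = a , i , p

AtLeast : {D : Set} → ℕ → (D → Set) → Set
AtLeast {D} k P = Σ (Fin k → D) (λ f → Injective _≡_ _≡_ f × (∀ m → P (f m)))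

-- GML^{i,u}(σ).  The grade of dia/inv R n φ is suc n (grades are ≥ 1);
-- the ungraded ◇_R is ◇_R^{≥1}, i.e. n = 0.

data GML (σ : Sig) : Set where
  top  : GML σ
  atom : UName σ → GML σ
  neg  : GML σ → GML σ
  and  : GML σ → GML σ → GML σ
  dia  : BName σ → ℕ → GML σ → GML σ
  inv  : BName σ → ℕ → GML σ → GML σ
  E    : GML σ → GML σ

_⊨G_at_ : ∀ {σ} (𝔄 : Struct σ) → GML σ → Dom 𝔄 → Set
𝔄 ⊨G top at d = ⊤
𝔄 ⊨G atom A at d = un 𝔄 A d
𝔄 ⊨G neg φ at d = ¬ (𝔄 ⊨G φ at d)
𝔄 ⊨G and φ ψ at d = (𝔄 ⊨G φ at d) × (𝔄 ⊨G ψ at d)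
𝔄 ⊨G dia R n φ at d = AtLeast (suc n) (λ e → bin 𝔄 R d e × (𝔄 ⊨G φ at e))
𝔄 ⊨G inv R n φ at d = AtLeast (suc n) (λ e → bin 𝔄 R e d × (𝔄 ⊨G φ at e))
𝔄 ⊨G E φ at d = Σ (Dom 𝔄) (λ e → 𝔄 ⊨G φ at e)

flG : ∀ {σ} → GML σ → GML σ
flG top = top
flG (atom A) = atom A
flG (neg φ) = neg (flG φ)
flG (and φ ψ) = and (flG φ) (flG ψ)
flG (dia R n φ) = dia R 0 (flG φ)
flG (inv R n φ) = inv R 0 (flG φ)
flG (E φ) = E (flG φ)

kG : ∀ {σ} → GML σ → ℕ
kG top = 0
kG (atom A) = 0
kG (neg φ) = kG φ
kG (and φ ψ) = kG φ ⊔ kG ψ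
kG (dia R n φ) = suc n ⊔ kG φ
kG (inv R n φ) = suc n ⊔ kG φ
kG (E φ) = kG φ

-- Equality-free C²(σ) over the variables x, y.
-- ∃≥ n v φ is ∃^{≥ suc n} v φ; plain ∃ is n = 0.

data Var : Set where
  x y : Var

_≟V_ : Var → Var → Bool
x ≟V x = true
y ≟V y = true
x ≟V y = false
y ≟V x = false

data C2 (σ : Sig) : Set where
  top  : C2 σ
  uat  : UName σ → Var → C2 σ
  bat  : BName σ → Var → Var → C2 σ
  neg  : C2 σ → C2 σ
  and  : C2 σ → C2 σ → C2 σ
  ∃≥   : ℕ → Var → C2 σ → C2 σ

free : ∀ {σ} → Var → C2 σ → Bool
free v top = false
free v (uat A w) = v ≟V w
free v (bat R w u) = (v ≟V w) ∨ (v ≟V u)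
free v (neg φ) = free v φ
free v (and φ ψ) = free v φ ∨ free v ψ
free v (∃≥ n w φ) with v ≟V w
... | true  = false
... | false = free v φ

update : {D : Set} → (Var → D) → Var → D → (Var → D)
update ρ v d w with v ≟V w
... | true  = d
... | false = ρ w

_⊨C_[_] : ∀ {σ} (𝔄 : Struct σ) → C2 σ → (Var → Dom 𝔄) → Set
𝔄 ⊨C top [ ρ ] = ⊤
𝔄 ⊨C uat A v [ ρ ] = un 𝔄 A (ρ v)
𝔄 ⊨C bat R v w [ ρ ] = bin 𝔄 R (ρ v) (ρ w)
𝔄 ⊨C neg φ [ ρ ] = ¬ (𝔄 ⊨C φ [ ρ ])
𝔄 ⊨C and φ ψ [ ρ ] = (𝔄 ⊨C φ [ ρ ]) × (𝔄 ⊨C ψ [ ρ ])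
𝔄 ⊨C ∃≥ n v φ [ ρ ] = AtLeast (suc n) (λ e → 𝔄 ⊨C φ [ update ρ v e ])

-- 𝔄 ⊨ φ(d) for a formula φ(x) (x ↦ d; y, which is not free, also ↦ d)
_⊨C_at_ : ∀ {σ} (𝔄 : Struct σ) → C2 σ → Dom 𝔄 → Set
𝔄 ⊨C φ at d = 𝔄 ⊨C φ [ (λ _ → d) ]

flC : ∀ {σ} → C2 σ → C2 σ
flC top = top
flC (uat A v) = uat A v
flC (bat R v w) = bat R v w
flC (neg φ) = neg (flC φ)
flC (and φ ψ) = and (flC φ) (flC ψ)
flC (∃≥ n v φ) = ∃≥ 0 v (flC φ)

kC : ∀ {σ} → C2 σ → ℕ
kC top = 0
kC (uat A v) = 0
kC (bat R v w) = 0
kC (neg φ) = kC φ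
kC (and φ ψ) = kC φ ⊔ kC ψ
kC (∃≥ n v φ) = suc n ⊔ kC φ

-- In 𝔄^κ the copies (a,0), (a,1), … of an element satisfy the same formulas, so as long as
-- a grade k does not exceed κ, "at least k successors satisfying φ" holds iff "some successor
-- satisfies φ". Hence every formula with grades ≤ κ holds at (a,i) in 𝔄^κ iff its flattening
-- holds at a in 𝔄; the four statements of the lemma are all equivalent to 𝔄 ⊨ fl(φ)(a).
module Submission where

open import Defs
open import Data.Nat using (ℕ; suc; _≤_; s≤s; z≤n)
open import Data.Nat.Properties using (≤-refl; ≤-trans; <-≤-trans; <⇒≤; m≤m⊔n; m≤n⊔m; ⊔-lub)
open import Data.Bool using (false)
open import Data.Fin using (Fin; toℕ; zero)
open import Data.Fin.Properties using (toℕ<n; toℕ-injective)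
open import Data.Product using (_×_; Σ; _,_; proj₁; proj₂)
open import Data.Product.Function.NonDependent.Propositional using (_×-⇔_)
open import Data.Product.Function.Dependent.Propositional using (Σ-⇔)
open import Data.Unit using (⊤; tt)
open import Function.Base using (_∘_)
open import Function.Definitions using (Injective)
open import Function.Bundles using (_⇔_; mk⇔; module Equivalence; _↠_; mk↠ₛ)
open import Function.Properties.Equivalence using (⇔-isEquivalence)
open import Function.Related.TypeIsomorphisms using (¬-cong-⇔)
open import Relation.Binary.PropositionalEquality using (_≡_; refl; cong; cong₂; subst)
open import Relation.Binary.Structures using (module IsEquivalence)
open import Level using (0ℓ)

open IsEquivalence (⇔-isEquivalence {ℓ = 0ℓ})
  using () renaming (refl to ⇔-refl; sym to ⇔-sym; trans to ⇔-trans)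

-- A grade k only needs k ≤ κ copies; the hypothesis k• < κ of the lemma is stronger.
_≤ι_ : ℕ → ℕ∞ → Set
m ≤ι fin n = m ≤ n
m ≤ι ω     = ⊤

≤ι-trans : ∀ {m n κ} → m ≤ n → n ≤ι κ → m ≤ι κ
≤ι-trans {κ = fin K} m≤n n≤K = ≤-trans m≤n n≤K
≤ι-trans {κ = ω}     m≤n _   = tt

<∞⇒<ι : ∀ {m κ} → fin m <∞ κ → m <ι κ
<∞⇒<ι {κ = fin K} m<K = m<K
<∞⇒<ι {κ = ω}     _   = tt

<ι⇒≤ι : ∀ {m κ} → m <ι κ → m ≤ι κ
<ι⇒≤ι {κ = fin K} m<K = <⇒≤ m<K
<ι⇒≤ι {κ = ω}     _   = tt

<ι⇒1≤ι : ∀ {m κ} → m <ι κ → 1 ≤ι κ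
<ι⇒1≤ι {κ = fin K} m<K = ≤-trans (s≤s z≤n) m<K
<ι⇒1≤ι {κ = ω}     _   = tt

toℕ<ι : ∀ {n κ} → suc n ≤ι κ → (m : Fin (suc n)) → toℕ m <ι κ
toℕ<ι {κ = fin K} n<K m = <-≤-trans (toℕ<n m) n<K
toℕ<ι {κ = ω}     _   m = tt

⇔-common : ∀ {A B C D X : Set} → A ⇔ X → B ⇔ X → C ⇔ X → D ⇔ X →
           (A ⇔ B) × (B ⇔ C) × (C ⇔ D)
⇔-common A⇔X B⇔X C⇔X D⇔X =
  ⇔-trans A⇔X (⇔-sym B⇔X) , ⇔-trans B⇔X (⇔-sym C⇔X) , ⇔-trans C⇔X (⇔-sym D⇔X)

atLeast-one : ∀ {D : Set} {P : D → Set} → AtLeast 1 P ⇔ Σ D P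
atLeast-one = mk⇔ (λ (f , _ , Pf) → f zero , Pf zero)
                  (λ (d , Pd) → (λ _ → d) , (λ { {zero} {zero} _ → refl }) , (λ _ → Pd))

module _ {σ : Sig} (𝔄 : Struct σ) {κ : ℕ∞} where

  copies : ∀ {n} → suc n ≤ι κ → Dom 𝔄 → Fin (suc n) → Dom (expand 𝔄 κ)
  copies κ>n a m = a , toℕ m , toℕ<ι κ>n m

  copies-injective : ∀ {n} (κ>n : suc n ≤ι κ) a → Injective _≡_ _≡_ (copies κ>n a)
  copies-injective κ>n a eq = toℕ-injective (cong (proj₁ ∘ proj₂) eq)

  proj₁-↠ : 1 ≤ι κ → Dom (expand 𝔄 κ) ↠ Dom 𝔄
  proj₁-↠ κ≥1 = mk↠ₛ {to = proj₁} (λ a → copies κ≥1 a zero , refl)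

  atLeast-copies : ∀ {n} {Q : Dom (expand 𝔄 κ) → Set} {Q' : Dom 𝔄 → Set} → suc n ≤ι κ →
                   (∀ a j → Q (a , j) ⇔ Q' a) → AtLeast (suc n) Q ⇔ AtLeast 1 Q'
  atLeast-copies κ>n Q⇔Q' = ⇔-trans (mk⇔
    (λ (f , _ , Qf) → proj₁ (f zero) , Equivalence.to (Q⇔Q' _ _) (Qf zero))
    (λ (a , Q'a) → copies κ>n a , (λ {_} {_} → copies-injective κ>n a)
                 , (λ _ → Equivalence.from (Q⇔Q' _ _) Q'a)))
    (⇔-sym atLeast-one)

flG-idem : ∀ {σ} (φ : GML σ) → flG (flG φ) ≡ flG φ
flG-idem top         = refl
flG-idem (atom A)    = refl
flG-idem (neg φ)     = cong neg (flG-idem φ)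
flG-idem (and φ ψ)   = cong₂ and (flG-idem φ) (flG-idem ψ)
flG-idem (dia R n φ) = cong (dia R 0) (flG-idem φ)
flG-idem (inv R n φ) = cong (inv R 0) (flG-idem φ)
flG-idem (E φ)       = cong E (flG-idem φ)

kG-flG≤1 : ∀ {σ} (φ : GML σ) → kG (flG φ) ≤ 1
kG-flG≤1 top         = z≤n
kG-flG≤1 (atom A)    = z≤n
kG-flG≤1 (neg φ)     = kG-flG≤1 φ
kG-flG≤1 (and φ ψ)   = ⊔-lub (kG-flG≤1 φ) (kG-flG≤1 ψ)
kG-flG≤1 (dia R n φ) = ⊔-lub ≤-refl (kG-flG≤1 φ)
kG-flG≤1 (inv R n φ) = ⊔-lub ≤-refl (kG-flG≤1 φ)
kG-flG≤1 (E φ)       = kG-flG≤1 φ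

flC-idem : ∀ {σ} (φ : C2 σ) → flC (flC φ) ≡ flC φ
flC-idem top         = refl
flC-idem (uat A v)   = refl
flC-idem (bat R v w) = refl
flC-idem (neg φ)     = cong neg (flC-idem φ)
flC-idem (and φ ψ)   = cong₂ and (flC-idem φ) (flC-idem ψ)
flC-idem (∃≥ n v φ)  = cong (∃≥ 0 v) (flC-idem φ)

kC-flC≤1 : ∀ {σ} (φ : C2 σ) → kC (flC φ) ≤ 1
kC-flC≤1 top         = z≤n
kC-flC≤1 (uat A v)   = z≤n
kC-flC≤1 (bat R v w) = z≤n
kC-flC≤1 (neg φ)     = kC-flC≤1 φ
kC-flC≤1 (and φ ψ)   = ⊔-lub (kC-flC≤1 φ) (kC-flC≤1 ψ)
kC-flC≤1 (∃≥ n v φ)  = ⊔-lub ≤-refl (kC-flC≤1 φ)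

update-map : ∀ {D D₀ : Set} (π : D → D₀) {ρ : Var → D} {ρ₀ : Var → D₀} →
             (∀ w → π (ρ w) ≡ ρ₀ w) → ∀ v e w → π (update ρ v e w) ≡ update ρ₀ v (π e) w
update-map π πρ≡ρ₀ x e x = refl
update-map π πρ≡ρ₀ x e y = πρ≡ρ₀ y
update-map π πρ≡ρ₀ y e x = πρ≡ρ₀ x
update-map π πρ≡ρ₀ y e y = refl

module _ {σ : Sig} (𝔄 : Struct σ) {κ : ℕ∞} where

  ⊨G-expand : 1 ≤ι κ → ∀ φ → kG φ ≤ι κ → ∀ d →
              (expand 𝔄 κ ⊨G φ at d) ⇔ (𝔄 ⊨G flG φ at proj₁ d)
  ⊨G-expand κ≥1 top         k≤κ d = ⇔-refl
  ⊨G-expand κ≥1 (atom A)    k≤κ d = ⇔-refl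
  ⊨G-expand κ≥1 (neg φ)     k≤κ d = ¬-cong-⇔ (⊨G-expand κ≥1 φ k≤κ d)
  ⊨G-expand κ≥1 (and φ ψ)   k≤κ d =
    ⊨G-expand κ≥1 φ (≤ι-trans (m≤m⊔n _ _) k≤κ) d
      ×-⇔ ⊨G-expand κ≥1 ψ (≤ι-trans (m≤n⊔m _ _) k≤κ) d
  ⊨G-expand κ≥1 (dia R n φ) k≤κ d =
    atLeast-copies 𝔄 (≤ι-trans (m≤m⊔n (suc n) (kG φ)) k≤κ)
      (λ a j → ⇔-refl {x = bin 𝔄 R (proj₁ d) a}
               ×-⇔ ⊨G-expand κ≥1 φ (≤ι-trans (m≤n⊔m (suc n) (kG φ)) k≤κ) (a , j))
  ⊨G-expand κ≥1 (inv R n φ) k≤κ d =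
    atLeast-copies 𝔄 (≤ι-trans (m≤m⊔n (suc n) (kG φ)) k≤κ)
      (λ a j → ⇔-refl {x = bin 𝔄 R a (proj₁ d)}
               ×-⇔ ⊨G-expand κ≥1 φ (≤ι-trans (m≤n⊔m (suc n) (kG φ)) k≤κ) (a , j))
  ⊨G-expand κ≥1 (E φ)       k≤κ d = Σ-⇔ (proj₁-↠ 𝔄 κ≥1) (λ {e} → ⊨G-expand κ≥1 φ k≤κ e)

  ⊨G-expand-flG : 1 ≤ι κ → ∀ φ d → (expand 𝔄 κ ⊨G flG φ at d) ⇔ (𝔄 ⊨G flG φ at proj₁ d)
  ⊨G-expand-flG κ≥1 φ d =
    subst (λ ψ → (expand 𝔄 κ ⊨G flG φ at d) ⇔ (𝔄 ⊨G ψ at proj₁ d)) (flG-idem φ)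
    (⊨G-expand κ≥1 (flG φ) (≤ι-trans (kG-flG≤1 φ) κ≥1) d)

  -- ρ₀ is proj₁ ∘ ρ, kept apart because update commutes with proj₁ only pointwise.
  ⊨C-expand : ∀ φ → kC φ ≤ι κ → ∀ ρ ρ₀ → (∀ w → proj₁ (ρ w) ≡ ρ₀ w) →
              (expand 𝔄 κ ⊨C φ [ ρ ]) ⇔ (𝔄 ⊨C flC φ [ ρ₀ ])
  ⊨C-expand top         k≤κ ρ ρ₀ ρ≡ρ₀ = ⇔-refl
  ⊨C-expand (uat A v)   k≤κ ρ ρ₀ ρ≡ρ₀ rewrite ρ≡ρ₀ v = ⇔-refl
  ⊨C-expand (bat R v w) k≤κ ρ ρ₀ ρ≡ρ₀ rewrite ρ≡ρ₀ v | ρ≡ρ₀ w = ⇔-refl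
  ⊨C-expand (neg φ)     k≤κ ρ ρ₀ ρ≡ρ₀ = ¬-cong-⇔ (⊨C-expand φ k≤κ ρ ρ₀ ρ≡ρ₀)
  ⊨C-expand (and φ ψ)   k≤κ ρ ρ₀ ρ≡ρ₀ =
    ⊨C-expand φ (≤ι-trans (m≤m⊔n _ _) k≤κ) ρ ρ₀ ρ≡ρ₀
      ×-⇔ ⊨C-expand ψ (≤ι-trans (m≤n⊔m _ _) k≤κ) ρ ρ₀ ρ≡ρ₀
  ⊨C-expand (∃≥ n v φ)  k≤κ ρ ρ₀ ρ≡ρ₀ =
    atLeast-copies 𝔄 (≤ι-trans (m≤m⊔n (suc n) (kC φ)) k≤κ)
      (λ a j → ⊨C-expand φ (≤ι-trans (m≤n⊔m (suc n) (kC φ)) k≤κ)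
                          (update ρ v (a , j)) (update ρ₀ v a) (update-map proj₁ ρ≡ρ₀ v (a , j)))

  ⊨C-expand-flC : 1 ≤ι κ → ∀ φ d → (expand 𝔄 κ ⊨C flC φ at d) ⇔ (𝔄 ⊨C flC φ at proj₁ d)
  ⊨C-expand-flC κ≥1 φ d =
    subst (λ ψ → (expand 𝔄 κ ⊨C flC φ at d) ⇔ (𝔄 ⊨C ψ at proj₁ d)) (flC-idem φ)
    (⊨C-expand (flC φ) (≤ι-trans (kC-flC≤1 φ) κ≥1) (λ _ → d) (λ _ → proj₁ d) (λ _ → refl))

lemma18 : ∀ (σ : Sig) (κ κ' : ℕ∞) (κ<κ' : κ <∞ κ') (𝔄 : Struct σ) (a : Dom 𝔄) (i : ℕ) (i<κ : i <ι κ) →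
    (∀ (φ : GML σ) → fin (kG φ) <∞ κ →
      ((expand 𝔄 κ ⊨G φ at copy 𝔄 κ a i i<κ) ⇔ (expand 𝔄 κ ⊨G flG φ at copy 𝔄 κ a i i<κ))
      × ((expand 𝔄 κ ⊨G flG φ at copy 𝔄 κ a i i<κ) ⇔ (expand 𝔄 κ' ⊨G flG φ at copy 𝔄 κ' a i (<ι-<∞ i<κ κ<κ')))
      × ((expand 𝔄 κ' ⊨G flG φ at copy 𝔄 κ' a i (<ι-<∞ i<κ κ<κ')) ⇔ (expand 𝔄 κ' ⊨G φ at copy 𝔄 κ' a i (<ι-<∞ i<κ κ<κ'))))
    × (∀ (φ : C2 σ) → free y φ ≡ false → fin (kC φ) <∞ κ →
      ((expand 𝔄 κ ⊨C φ at copy 𝔄 κ a i i<κ) ⇔ (expand 𝔄 κ ⊨C flC φ at copy 𝔄 κ a i i<κ))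
      × ((expand 𝔄 κ ⊨C flC φ at copy 𝔄 κ a i i<κ) ⇔ (expand 𝔄 κ' ⊨C flC φ at copy 𝔄 κ' a i (<ι-<∞ i<κ κ<κ')))
      × ((expand 𝔄 κ' ⊨C flC φ at copy 𝔄 κ' a i (<ι-<∞ i<κ κ<κ')) ⇔ (expand 𝔄 κ' ⊨C φ at copy 𝔄 κ' a i (<ι-<∞ i<κ κ<κ'))))
lemma18 σ κ κ' κ<κ' 𝔄 a i i<κ =
  (λ φ k<κ → ⇔-common
     (⊨G-expand 𝔄 κ≥1 φ (≤κ k<κ) _) (⊨G-expand-flG 𝔄 κ≥1 φ _)
     (⊨G-expand-flG 𝔄 κ'≥1 φ _) (⊨G-expand 𝔄 κ'≥1 φ (≤κ' k<κ) _)) ,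
  -- x and y are both assigned the point, so whether y is free does not matter.
  (λ φ _ k<κ → ⇔-common
     (⊨C-expand 𝔄 φ (≤κ k<κ) _ _ (λ _ → refl)) (⊨C-expand-flC 𝔄 κ≥1 φ _)
     (⊨C-expand-flC 𝔄 κ'≥1 φ _) (⊨C-expand 𝔄 φ (≤κ' k<κ) _ _ (λ _ → refl)))
  where
  κ≥1 : 1 ≤ι κ
  κ≥1 = <ι⇒1≤ι i<κ
  κ'≥1 : 1 ≤ι κ'
  κ'≥1 = <ι⇒1≤ι (<ι-<∞ i<κ κ<κ')
  ≤κ : ∀ {k} → fin k <∞ κ → k ≤ι κ
  ≤κ k<κ = <ι⇒≤ι (<∞⇒<ι k<κ)
  ≤κ' : ∀ {k} → fin k <∞ κ → k ≤ι κ'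
  ≤κ' k<κ = <ι⇒≤ι (<ι-<∞ (<∞⇒<ι k<κ) κ<κ')
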